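{- Let $F$ be a set of facilities with capacities $u_f\in\mathbb{Z}_{\ge 0}$, $C$ a set of clients, $d$ a metric on $F\cup C$ and $k$ a positive integer, forming an instance of Capacitated $k$-Median. Let $A\subseteq F$ be the set of facilities opened by some solution of the Uncapacitated $k$-Median relaxation that opens at most $\ell$ facilities ($\ell\ge k$) and connects every client to a closest facility of $A$; denote its cost by $\mathrm{cost}(A,d)=\sum_{c\in C}\min_{f\in A}d(c,f)$. Let $d_\ell$ be the $\ell$-centered metric constructed from $A$ as described in the context. Let $\phi^{*}:C\to F$ be an optimal solution of the Capacitated $k$-Median instance with metric $d$. Then \[\sum_{c\in C} d(c,\phi^*(c)) \le \sum_{c\in C} d_\ell(c,\phi^*(c)) \le 3\sum_{c\in C} d(c,\phi^*(c)) + 4\,\mathrm{cost}(A,d).\]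
   Context: Capacitated $k$-Median (CKM): given facilities $F$ with capacities $u_f\in\mathbb{Z}_{\ge0}$, clients $C$, a metric $d$ on $F\cup C$ and an integer $k$, a solution is a set $S\subseteq F$ with $|S|\le k$ together with an assignment $\phi:C\to S$ with $|\phi^{ -1}(f)|\le u_f$ for all $f\in S$; its cost in a metric $d'$ is $\sum_{c\in C}d'(c,\phi(c))$, and the goal is to minimize the cost in $d$. Construction of $d_\ell$: for each $f\in A$ create a new vertex (center) $s^f$ at distance $0$ from $f$, extending $d$ to $F\cup C\cup S$ where $S=\{s^f: f\in A\}$. Build a weighted graph on $F\cup C\cup S$: $S$ forms a complete graph with edge lengths given by $d$, and each $v\in F\cup C$ is joined by a single edge to a center $s^v\in S$ closest to $v$ (in the extended $d$), of length $d(v,s^v)$. $d_\ell$ is the shortest-path metric of this graph.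
   Formalization: The metric d, the edge lengths of the graph and $d_\ell$ take rational values. -}

module Defs where

open import Data.Nat as ℕ using (ℕ; zero; suc)
open import Data.Fin using (Fin; zero; suc; _≟_)
open import Data.Fin.Subset using (Subset; _∈_; ∣_∣)
open import Data.Vec using (tabulate)
open import Data.Sum using (_⊎_; inj₁; inj₂)
open import Data.Product using (_×_; Σ; ∃; ∃-syntax; _,_)
open import Data.Rational using (ℚ; 0ℚ; _+_; _⊓_; _≤_)
open import Relation.Nullary using (does)
open import Relation.Binary.PropositionalEquality using (_≡_)
open import Function.Definitions using (Injective)

-- Points of F ∪ C : facilities are inj₁, clients are inj₂.
Pt : ℕ → ℕ → Set
Pt nF nC = Fin nF ⊎ Fin nC

sumFin : (n : ℕ) → (Fin n → ℚ) → ℚ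
sumFin zero    g = 0ℚ
sumFin (suc n) g = g zero + sumFin n (λ i → g (suc i))

minFin : (m : ℕ) → (Fin (suc m) → ℚ) → ℚ
minFin zero    g = g zero
minFin (suc m) g = g zero ⊓ minFin m (λ i → g (suc i))

record IsMetric {X : Set} (d : X → X → ℚ) : Set where
  field
    nonneg : ∀ x y → 0ℚ ≤ d x y
    refl0  : ∀ x → d x x ≡ 0ℚ
    sym    : ∀ x y → d x y ≡ d y x
    tri    : ∀ x y z → d x z ≤ d x y + d y z

assignCost : ∀ {nF nC} → (Pt nF nC → Pt nF nC → ℚ) → (Fin nC → Fin nF) → ℚ
assignCost {nF} {nC} d' φ = sumFin nC (λ c → d' (inj₂ c) (inj₁ (φ c)))

preimage : ∀ {nF nC} → (Fin nC → Fin nF) → Fin nF → Subset nC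
preimage φ f = tabulate (λ c → does (φ c ≟ f))

Feasible : ∀ {nF nC} → (Fin nF → ℕ) → ℕ → (Fin nC → Fin nF) → Set
Feasible {nF} {nC} u k φ =
  Σ (Subset nF) λ S →
    (∣ S ∣ ℕ.≤ k) × (∀ c → φ c ∈ S) × (∀ f → ∣ preimage φ f ∣ ℕ.≤ u f)

OptimalCKM : ∀ {nF nC} → (Pt nF nC → Pt nF nC → ℚ) → (Fin nF → ℕ) → ℕ →
             (Fin nC → Fin nF) → Set
OptimalCKM d u k φ* =
  Feasible u k φ* × (∀ φ → Feasible u k φ → assignCost d φ* ≤ assignCost d φ)

-- cost(A,d) = Σ_c min_{f∈A} d(c,f), with A given by an injective
-- enumeration a : Fin (suc m) → F.
costA : ∀ {nF nC m} → (Pt nF nC → Pt nF nC → ℚ) → (Fin (suc m) → Fin nF) → ℚ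
costA {nF} {nC} {m} d a = sumFin nC (λ c → minFin m (λ j → d (inj₂ c) (inj₁ (a j))))

-- σ picks, for each v ∈ F ∪ C, a closest center s^{a j} (d(v,s^f) = d(v,f)).
ClosestCenter : ∀ {nF nC m} → (Pt nF nC → Pt nF nC → ℚ) → (Fin (suc m) → Fin nF) →
                (Pt nF nC → Fin (suc m)) → Set
ClosestCenter d a σ = ∀ v j → d v (inj₁ (a (σ v))) ≤ d v (inj₁ (a j))

-- Vertices of the graph: points of F ∪ C, and centers s^{a j} (indexed by j).
Vtx : ℕ → ℕ → ℕ → Set
Vtx nF nC m = Pt nF nC ⊎ Fin (suc m)

-- Weighted edges of the graph (undirected: both orientations listed).
data Edge {nF nC m : ℕ} (d : Pt nF nC → Pt nF nC → ℚ) (a : Fin (suc m) → Fin nF)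
          (σ : Pt nF nC → Fin (suc m)) : Vtx nF nC m → Vtx nF nC m → ℚ → Set where
  center : ∀ i j → Edge d a σ (inj₂ i) (inj₂ j) (d (inj₁ (a i)) (inj₁ (a j)))
  up     : ∀ v → Edge d a σ (inj₁ v) (inj₂ (σ v)) (d v (inj₁ (a (σ v))))
  down   : ∀ v → Edge d a σ (inj₂ (σ v)) (inj₁ v) (d v (inj₁ (a (σ v))))

data Walk {nF nC m : ℕ} (d : Pt nF nC → Pt nF nC → ℚ) (a : Fin (suc m) → Fin nF)
          (σ : Pt nF nC → Fin (suc m)) : Vtx nF nC m → Vtx nF nC m → ℚ → Set where
  nil  : ∀ x → Walk d a σ x x 0ℚ
  cons : ∀ {x y z l r} → Edge d a σ x y l → Walk d a σ y z r → Walk d a σ x z (l + r)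

IsShortestDist : ∀ {nF nC m} → (Pt nF nC → Pt nF nC → ℚ) → (Fin (suc m) → Fin nF) →
                 (Pt nF nC → Fin (suc m)) → Vtx nF nC m → Vtx nF nC m → ℚ → Set
IsShortestDist d a σ x y r = Walk d a σ x y r × (∀ r' → Walk d a σ x y r' → r ≤ r')

-- dℓ is the ℓ-centered metric (shortest-path metric restricted to F ∪ C).
IsCenteredMetric : ∀ {nF nC m} → (Pt nF nC → Pt nF nC → ℚ) → (Fin (suc m) → Fin nF) →
                   (Pt nF nC → Fin (suc m)) → (Pt nF nC → Pt nF nC → ℚ) → Set
IsCenteredMetric d a σ dℓ = ∀ x y → IsShortestDist d a σ (inj₁ x) (inj₁ y) (dℓ x y)

{-# OPTIONS --safe #-}
-- Placing each center s^f at its facility f turns every edge of the graph into a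
-- segment no shorter than the d-distance of its endpoints, so by the triangle
-- inequality every walk, and hence d_ℓ, dominates d.  Conversely, d_ℓ(x, y) is at
-- most the length of the walk x → s^x → s^y → y.  Since s^y is closest to y,
-- d(y, s^y) ≤ d(y, s^x) ≤ d(x, y) + d(x, s^x), and the middle leg is at most
-- d(x, s^x) + d(x, y) + d(y, s^y); altogether d_ℓ(x, y) ≤ 3 d(x, y) + 4 d(x, s^x).
-- Summing over the clients with y = φ(c) gives both bounds for every assignment φ.
module Submission where

open import Defs
open import Algebra using (CommutativeMonoid)
open import Data.Nat as ℕ using (ℕ; suc; zero)
open import Data.Fin using (Fin; zero; suc)
open import Data.Integer using (+_)
open import Data.Rational using (ℚ; _/_; _+_; _*_; _≤_; 0ℚ)
open import Data.Rational.Properties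
  using (≤-trans; ≤-refl; ≤-reflexive; +-mono-≤; ⊓-glb; *-monoˡ-≤-nonNeg;
         *-zeroʳ; *-distribˡ-+; +-0-commutativeMonoid; module ≤-Reasoning)
open import Algebra.Properties.CommutativeSemigroup
  (CommutativeMonoid.commutativeSemigroup +-0-commutativeMonoid) using (interchange)
open import Data.Rational.Solver using (module +-*-Solver)
open import Data.Sum using (inj₁; inj₂)
open import Data.Product using (_×_; _,_; proj₁; proj₂)
open import Function.Definitions using (Injective)
open import Relation.Binary.PropositionalEquality using (_≡_; refl; sym; cong₂)

sumFin-mono : ∀ n {g h : Fin n → ℚ} → (∀ i → g i ≤ h i) → sumFin n g ≤ sumFin n h
sumFin-mono zero    g≤h = ≤-refl
sumFin-mono (suc n) g≤h = +-mono-≤ (g≤h zero) (sumFin-mono n (λ i → g≤h (suc i)))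

sumFin-distrib-+ : ∀ n (g h : Fin n → ℚ) →
                   sumFin n (λ i → g i + h i) ≡ sumFin n g + sumFin n h
sumFin-distrib-+ zero    g h = refl
sumFin-distrib-+ (suc n) g h
  rewrite sumFin-distrib-+ n (λ i → g (suc i)) (λ i → h (suc i)) =
  interchange (g zero) (h zero) (sumFin n (λ i → g (suc i))) (sumFin n (λ i → h (suc i)))

sumFin-distribˡ-* : ∀ n p (g : Fin n → ℚ) → sumFin n (λ i → p * g i) ≡ p * sumFin n g
sumFin-distribˡ-* zero    p g = sym (*-zeroʳ p)
sumFin-distribˡ-* (suc n) p g
  rewrite sumFin-distribˡ-* n p (λ i → g (suc i)) =
  sym (*-distribˡ-+ p (g zero) (sumFin n (λ i → g (suc i))))

minFin-greatest : ∀ m (g : Fin (suc m) → ℚ) {x} → (∀ j → x ≤ g j) → x ≤ minFin m g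
minFin-greatest zero    g x≤g = x≤g zero
minFin-greatest (suc m) g x≤g =
  ⊓-glb (x≤g zero) (minFin-greatest m (λ i → g (suc i)) (λ i → x≤g (suc i)))

module CenteredGraph {nF nC m : ℕ} (d : Pt nF nC → Pt nF nC → ℚ) (isMetric : IsMetric d)
                     (a : Fin (suc m) → Fin nF) (σ : Pt nF nC → Fin (suc m)) where
  open IsMetric isMetric renaming (sym to d-sym)

  position : Vtx nF nC m → Pt nF nC
  position (inj₁ v) = v
  position (inj₂ j) = inj₁ (a j)

  dist-≤-edge : ∀ {x y l} → Edge d a σ x y l → d (position x) (position y) ≤ l
  dist-≤-edge (center i j) = ≤-refl
  dist-≤-edge (up v)       = ≤-refl
  dist-≤-edge (down v)     = ≤-reflexive (d-sym (inj₁ (a (σ v))) v)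

  dist-≤-walk : ∀ {x y r} → Walk d a σ x y r → d (position x) (position y) ≤ r
  dist-≤-walk (nil x) = ≤-reflexive (refl0 (position x))
  dist-≤-walk (cons {x} {y} {z} e w) =
    ≤-trans (tri (position x) (position y) (position z)) (+-mono-≤ (dist-≤-edge e) (dist-≤-walk w))

  centerOf : Pt nF nC → Pt nF nC
  centerOf v = inj₁ (a (σ v))

  detourLength : Pt nF nC → Pt nF nC → ℚ
  detourLength x y = d x (centerOf x) + (d (centerOf x) (centerOf y) + (d y (centerOf y) + 0ℚ))

  detour : ∀ x y → Walk d a σ (inj₁ x) (inj₁ y) (detourLength x y)
  detour x y = cons (up x) (cons (center (σ x) (σ y)) (cons (down y) (nil (inj₁ y))))

  module _ (closest : ClosestCenter d a σ) (x y : Pt nF nC) where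
    private
      X Y : ℚ
      X = d x y
      Y = d x (centerOf x)

    dist-centerOf-≤ : d y (centerOf y) ≤ X + Y
    dist-centerOf-≤ = begin
      d y (centerOf y)  ≤⟨ closest y (σ x) ⟩
      d y (centerOf x)  ≤⟨ tri y x (centerOf x) ⟩
      d y x + Y         ≡⟨ cong₂ _+_ (d-sym y x) refl ⟩
      X + Y             ∎
      where open ≤-Reasoning

    dist-centers-≤ : d (centerOf x) (centerOf y) ≤ Y + (X + (X + Y))
    dist-centers-≤ = begin
      d (centerOf x) (centerOf y)
        ≤⟨ tri (centerOf x) x (centerOf y) ⟩
      d (centerOf x) x + d x (centerOf y)
        ≤⟨ +-mono-≤ (≤-reflexive (d-sym (centerOf x) x)) (tri x y (centerOf y)) ⟩
      Y + (X + d y (centerOf y))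
        ≤⟨ +-mono-≤ (≤-refl {Y}) (+-mono-≤ (≤-refl {X}) dist-centerOf-≤) ⟩
      Y + (X + (X + Y))
        ∎
      where open ≤-Reasoning

    detourLength-≤ : detourLength x y ≤ (+ 3 / 1) * X + (+ 4 / 1) * Y
    detourLength-≤ = begin
      detourLength x y
        ≤⟨ +-mono-≤ (≤-refl {Y})
             (+-mono-≤ dist-centers-≤ (+-mono-≤ dist-centerOf-≤ (≤-refl {0ℚ}))) ⟩
      Y + ((Y + (X + (X + Y))) + ((X + Y) + 0ℚ))
        ≡⟨ solve 2 (λ X Y → Y :+ ((Y :+ (X :+ (X :+ Y))) :+ ((X :+ Y) :+ con 0ℚ))
                            := con (+ 3 / 1) :* X :+ con (+ 4 / 1) :* Y) refl X Y ⟩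
      (+ 3 / 1) * X + (+ 4 / 1) * Y
        ∎
      where open ≤-Reasoning
            open +-*-Solver

  module _ {dℓ : Pt nF nC → Pt nF nC → ℚ} (isCentered : IsCenteredMetric d a σ dℓ) where

    dist-≤-centered : ∀ x y → d x y ≤ dℓ x y
    dist-≤-centered x y = dist-≤-walk (proj₁ (isCentered x y))

    centered-≤-detourLength : ∀ x y → dℓ x y ≤ detourLength x y
    centered-≤-detourLength x y = proj₂ (isCentered x y) _ (detour x y)

    assignCost-≤-centered : ∀ φ → assignCost d φ ≤ assignCost dℓ φ
    assignCost-≤-centered φ = sumFin-mono nC (λ c → dist-≤-centered (inj₂ c) (inj₁ (φ c)))

    centered-assignCost-≤ : ClosestCenter d a σ → ∀ φ →
      assignCost dℓ φ ≤ (+ 3 / 1) * assignCost d φ + (+ 4 / 1) * costA {nF} {nC} {m} d a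
    centered-assignCost-≤ closest φ = begin
      assignCost dℓ φ
        ≤⟨ sumFin-mono nC perClient ⟩
      sumFin nC (λ c → (+ 3 / 1) * X c + (+ 4 / 1) * Y c)
        ≡⟨ sumFin-distrib-+ nC _ _ ⟩
      sumFin nC (λ c → (+ 3 / 1) * X c) + sumFin nC (λ c → (+ 4 / 1) * Y c)
        ≡⟨ cong₂ _+_ (sumFin-distribˡ-* nC (+ 3 / 1) X) (sumFin-distribˡ-* nC (+ 4 / 1) Y) ⟩
      (+ 3 / 1) * assignCost d φ + (+ 4 / 1) * costA {nF} {nC} {m} d a
        ∎
      where
      open ≤-Reasoning
      X Y : Fin nC → ℚ
      X c = d (inj₂ c) (inj₁ (φ c))
      Y c = minFin m (λ j → d (inj₂ c) (inj₁ (a j)))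

      perClient : ∀ c → dℓ (inj₂ c) (inj₁ (φ c)) ≤ (+ 3 / 1) * X c + (+ 4 / 1) * Y c
      perClient c = begin
        dℓ (inj₂ c) (inj₁ (φ c))
          ≤⟨ centered-≤-detourLength _ _ ⟩
        detourLength (inj₂ c) (inj₁ (φ c))
          ≤⟨ detourLength-≤ closest _ _ ⟩
        (+ 3 / 1) * X c + (+ 4 / 1) * d (inj₂ c) (centerOf (inj₂ c))
          ≤⟨ +-mono-≤ (≤-refl {(+ 3 / 1) * X c})
               (*-monoˡ-≤-nonNeg (+ 4 / 1) (minFin-greatest m _ (closest (inj₂ c)))) ⟩
        (+ 3 / 1) * X c + (+ 4 / 1) * Y c
          ∎

lemma2 : (nF nC : ℕ) (u : Fin nF → ℕ) (k ℓ : ℕ) → 1 ℕ.≤ k → k ℕ.≤ ℓ →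
    (d : Pt nF nC → Pt nF nC → ℚ) → IsMetric d →
    (m : ℕ) (a : Fin (suc m) → Fin nF) → Injective _≡_ _≡_ a → suc m ℕ.≤ ℓ →
    (σ : Pt nF nC → Fin (suc m)) → ClosestCenter d a σ →
    (dℓ : Pt nF nC → Pt nF nC → ℚ) → IsCenteredMetric d a σ dℓ →
    (φ* : Fin nC → Fin nF) → OptimalCKM d u k φ* →
    (assignCost d φ* ≤ assignCost dℓ φ*) ×
    (assignCost dℓ φ* ≤ ((+ 3 / 1) * assignCost d φ* + (+ 4 / 1) * costA {nF} {nC} {m} d a))
lemma2 nF nC u k ℓ _ _ d isMetric m a _ _ σ closest dℓ isCentered φ* _ =
  assignCost-≤-centered isCentered φ* , centered-assignCost-≤ isCentered closest φ*
  where open CenteredGraph d isMetric a σ
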